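{- Fix an integer $\ell\ge 1$ and indeterminates $Y_1,\dots,Y_\ell$. Then $$\sum_{n=0}^{\infty}\det\big(M_{n,\ell}(\mathbf{Y})\big)\frac{x^n}{n!}=\exp\!\left(Y_1x+Y_2\frac{x^2}{2}+\cdots+Y_\ell\frac{x^\ell}{\ell}\right),$$ where the determinant of the $0\times 0$ matrix $M_{0,\ell}$ is $1$.
   Context: Let $\imath=\sqrt{ -1}$. For integers $n\ge 0$, $\ell\ge 1$, $M_{n,\ell}(\mathbf{Y})$ is the $n\times n$ matrix with rows and columns indexed by $1,\dots,n$ whose $(k,j)$ entry is $\imath^{\,j-k}Y_{j-k+1}$ if $0\le j-k\le \ell-1$, is $\imath\, j$ if $k=j+1$, and is $0$ otherwise. (E.g. $M_{2,\ell}=\begin{pmatrix}Y_1 & \imath Y_2\\ \imath & Y_1\end{pmatrix}$ for $\ell\ge 2$.) -}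

module Defs where

open import Algebra.Bundles using (CommutativeRing)
open import Data.Nat as ℕ using (ℕ; zero; suc; _∸_)
open import Data.Fin using (Fin; zero; suc; toℕ; punchIn)
open import Data.Bool using (if_then_else_)
open import Relation.Nullary.Decidable using (does)

module _ {c r} (R : CommutativeRing c r) where
  open CommutativeRing R using (Carrier; _+_; _*_; -_; 0#; 1#)

  fromℕ : ℕ → Carrier
  fromℕ zero = 0#
  fromℕ (suc n) = 1# + fromℕ n

  pow : Carrier → ℕ → Carrier
  pow a zero = 1#
  pow a (suc n) = a * pow a n

  sumTo : ℕ → (ℕ → Carrier) → Carrier
  sumTo zero f = 0#
  sumTo (suc n) f = sumTo n f + f n

  sumFin : ∀ n → (Fin n → Carrier) → Carrier
  sumFin zero f = 0#
  sumFin (suc n) f = f zero + sumFin n (λ i → f (suc i))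

  det : ∀ n → (Fin n → Fin n → Carrier) → Carrier
  det zero A = 1#
  det (suc n) A = sumFin (suc n) λ j →
    pow (- 1#) (toℕ j) * A zero j * det n (λ a b → A (suc a) (punchIn j b))

  -- inverse of k! given inverses inv m of the integers m ≥ 1
  invFact : (ℕ → Carrier) → ℕ → Carrier
  invFact inv zero = 1#
  invFact inv (suc k) = invFact inv k * inv (suc k)

  -- entryY ℓ Y d = Y_{d+1} (1-based) if d < ℓ, and 0 otherwise
  entryY : ∀ ℓ → (Fin ℓ → Carrier) → ℕ → Carrier
  entryY zero Y d = 0#
  entryY (suc ℓ) Y zero = Y zero
  entryY (suc ℓ) Y (suc d) = entryY ℓ (λ i → Y (suc i)) d

  -- (k,j) entry of M_{n,ℓ}(Y), with a = k-1, b = j-1 (0-based indices):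
  --   ι^{j-k} Y_{j-k+1} if 0 ≤ j-k ≤ ℓ-1 ; ι·j if k = j+1 ; 0 otherwise
  Mentry : (ι : Carrier) → ∀ ℓ → (Fin ℓ → Carrier) → ℕ → ℕ → Carrier
  Mentry ι ℓ Y a b =
    if does (a ℕ.≤? b) then pow ι (b ∸ a) * entryY ℓ Y (b ∸ a)
    else (if does (a ℕ.≟ suc b) then ι * fromℕ (suc b) else 0#)

  M : (ι : Carrier) → ∀ n ℓ → (Fin ℓ → Carrier) → Fin n → Fin n → Carrier
  M ι n ℓ Y k j = Mentry ι ℓ Y (toℕ k) (toℕ j)

  Series : Set c
  Series = ℕ → Carrier

  oneS : Series
  oneS zero = 1#
  oneS (suc n) = 0#

  mulS : Series → Series → Series
  mulS f g n = sumTo (suc n) λ i → f i * g (n ∸ i)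

  powS : Series → ℕ → Series
  powS g zero = oneS
  powS g (suc k) = mulS g (powS g k)

  -- exp g = Σ_k g^k / k!, for g with zero constant term; the coefficient of
  -- x^n only receives contributions from k ≤ n.
  expS : (ℕ → Carrier) → Series → Series
  expS inv g n = sumTo (suc n) λ k → invFact inv k * powS g k n

  logSeries : (ℕ → Carrier) → ∀ ℓ → (Fin ℓ → Carrier) → Series
  logSeries inv ℓ Y zero = 0#
  logSeries inv ℓ Y (suc d) = entryY ℓ Y d * inv (suc d)

  detSeries : (ℕ → Carrier) → (ι : Carrier) → ∀ ℓ → (Fin ℓ → Carrier) → Series
  detSeries inv ι ℓ Y n = det n (M ι n ℓ Y) * invFact inv n

module Submission where

-- M_{n,ℓ} is lower Hessenberg, so expanding along the first row expresses the determinant D_s(m)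
-- of its m × m diagonal block starting at index s through blocks further down the diagonal:
-- D_s(m+1) = Σ_j Y_{j+1} (s+1)⋯(s+j) D_{s+j+1}(m−j), the signs (−1)^j cancelling against ι^{2j}.
-- Read as a sum over compositions of m+1, the same quantity can be expanded from the other end,
-- giving D_0(m+1) = Σ_i Y_{i+1} (m!/(m−i)!) D_0(m−i). Thus u_n = D_0(n)/n! solves u′ = c u with
-- c = Σ_i Y_{i+1} x^i and u_0 = 1. So does exp(Y_1 x + ⋯ + Y_ℓ x^ℓ/ℓ), by the power rule
-- x (g^{k+1})′ = (k+1) (x g′) g^k, and such a solution is unique when 1, 2, 3, … are invertible.

open import Defs
open import Algebra.Bundles using (CommutativeRing)
open import Data.Nat using (ℕ; suc; _≤_)
open import Data.Fin using (Fin)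
open import Level using (Level)

import Algebra.Properties.CommutativeSemigroup as CommutativeSemigroupProperties
open import Data.Bool.Properties using (if-cong)
open import Data.Fin as Fin using (toℕ; punchIn)
open import Data.Nat as ℕ using (zero; _∸_; _<_; z≤n; s≤s)
open import Data.Nat.Induction using (<-rec)
import Data.Nat.Properties as ℕₚ
open import Relation.Binary.PropositionalEquality as ≡ using (_≡_)
open import Relation.Nullary.Decidable using (dec-true; dec-false)

∸-suc : ∀ {m j} → j < m → m ∸ j ≡ suc (m ∸ suc j)
∸-suc {suc m} (s≤s j≤m) = ℕₚ.+-∸-assoc 1 j≤m

∸-comm : ∀ m n o → m ∸ n ∸ o ≡ m ∸ o ∸ n
∸-comm m n o = ≡.trans (ℕₚ.∸-+-assoc m n o)
  (≡.trans (≡.cong (m ∸_) (ℕₚ.+-comm n o)) (≡.sym (ℕₚ.∸-+-assoc m o n)))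

∸-suc-comm : ∀ m j i → m ∸ suc j ∸ i ≡ m ∸ suc i ∸ j
∸-suc-comm m j i = ≡.trans (ℕₚ.∸-+-assoc m (suc j) i)
  (≡.trans (≡.cong (λ k → m ∸ suc k) (ℕₚ.+-comm j i)) (≡.sym (ℕₚ.∸-+-assoc m (suc i) j)))

module ℕ+ = CommutativeSemigroupProperties ℕₚ.+-commutativeSemigroup

+-∸-reindex : ∀ s {m j i} → j < m → i ≤ m ∸ suc j → suc j ℕ.+ s ℕ.+ (m ∸ suc j ∸ i) ≡ s ℕ.+ (m ∸ i)
+-∸-reindex s {m} {j} {i} j<m i≤m∸1+j = ≡.trans (ℕ+.xy∙z≈y∙xz (suc j) s _) (≡.cong (s ℕ.+_)
  (≡.trans (≡.cong (suc j ℕ.+_) (∸-comm m (suc j) i)) (ℕₚ.m+[n∸m]≡n 1+j≤m∸i)))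
  where
  1+j≤m∸i : suc j ≤ m ∸ i
  1+j≤m∸i = ℕₚ.m+n≤o⇒m≤o∸n (suc j)
    (≡.subst (_≤ m) (ℕₚ.+-comm i (suc j)) (ℕₚ.m≤o∸n⇒m+n≤o i j<m i≤m∸1+j))

module _ {c r} (R : CommutativeRing c r) where
  open CommutativeRing R hiding (zero)
  open import Relation.Binary.Reasoning.Setoid setoid
  open import Algebra.Properties.Ring ring using (-1*x≈-x; -‿involutive)
  module +-Comm = CommutativeSemigroupProperties +-commutativeSemigroup
  module *-Comm = CommutativeSemigroupProperties *-commutativeSemigroup

  ≈-cong : ∀ {A : Set} (f : A → Carrier) {x y} → x ≡ y → f x ≈ f y
  ≈-cong f x≡y = reflexive (≡.cong f x≡y)

  ∑ : ℕ → (ℕ → Carrier) → Carrier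
  ∑ = sumTo R

  ∑-cong-< : ∀ n {f g} → (∀ i → i < n → f i ≈ g i) → ∑ n f ≈ ∑ n g
  ∑-cong-< zero    f≈g = refl
  ∑-cong-< (suc n) f≈g =
    +-cong (∑-cong-< n (λ i i<n → f≈g i (ℕₚ.m<n⇒m<1+n i<n))) (f≈g n (ℕₚ.n<1+n n))

  ∑-cong : ∀ n {f g} → (∀ i → f i ≈ g i) → ∑ n f ≈ ∑ n g
  ∑-cong n f≈g = ∑-cong-< n (λ i _ → f≈g i)

  ∑-length : ∀ f {m n} → m ≡ n → ∑ m f ≈ ∑ n f
  ∑-length f m≡n = ≈-cong (λ k → ∑ k f) m≡n

  ∑-head : ∀ n f → ∑ (suc n) f ≈ f 0 + ∑ n (λ i → f (suc i))
  ∑-head zero    f = +-comm 0# (f 0)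
  ∑-head (suc n) f = trans (+-congʳ (∑-head n f)) (+-assoc _ _ _)

  ∑-distrib-+ : ∀ n f g → ∑ n (λ i → f i + g i) ≈ ∑ n f + ∑ n g
  ∑-distrib-+ zero    f g = sym (+-identityˡ 0#)
  ∑-distrib-+ (suc n) f g = trans (+-congʳ (∑-distrib-+ n f g)) (+-Comm.interchange _ _ _ _)

  *-distribˡ-∑ : ∀ n a f → a * ∑ n f ≈ ∑ n (λ i → a * f i)
  *-distribˡ-∑ zero    a f = zeroʳ a
  *-distribˡ-∑ (suc n) a f = trans (distribˡ a _ _) (+-congʳ (*-distribˡ-∑ n a f))

  *-distribʳ-∑ : ∀ n a f → ∑ n f * a ≈ ∑ n (λ i → f i * a)
  *-distribʳ-∑ zero    a f = zeroˡ a
  *-distribʳ-∑ (suc n) a f = trans (distribʳ a _ _) (+-congʳ (*-distribʳ-∑ n a f))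

  ∑-zero : ∀ n {f} → (∀ i → i < n → f i ≈ 0#) → ∑ n f ≈ 0#
  ∑-zero n {f} f≈0 = trans (∑-cong-< n f≈0) (zeros n)
    where
    zeros : ∀ n → ∑ n (λ _ → 0#) ≈ 0#
    zeros zero    = refl
    zeros (suc n) = trans (+-identityʳ _) (zeros n)

  ∑-pad : ∀ k n f → (∀ i → n ≤ i → f i ≈ 0#) → ∑ (k ℕ.+ n) f ≈ ∑ n f
  ∑-pad zero    n f f≈0 = refl
  ∑-pad (suc k) n f f≈0 =
    trans (+-cong (∑-pad k n f f≈0) (f≈0 (k ℕ.+ n) (ℕₚ.m≤n+m n k))) (+-identityʳ _)

  ∑-comm : ∀ m n (G : ℕ → ℕ → Carrier) → ∑ m (λ i → ∑ n (G i)) ≈ ∑ n (λ j → ∑ m (λ i → G i j))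
  ∑-comm zero    n G = sym (∑-zero n (λ _ _ → refl))
  ∑-comm (suc m) n G = trans (+-congʳ (∑-comm m n G)) (sym (∑-distrib-+ n _ _))

  ∑-reverse : ∀ n f → ∑ n f ≈ ∑ n (λ i → f (n ∸ suc i))
  ∑-reverse zero    f = refl
  ∑-reverse (suc n) f = begin
    ∑ n f + f n                        ≈⟨ +-congʳ (∑-reverse n f) ⟩
    ∑ n (λ i → f (n ∸ suc i)) + f n    ≈⟨ +-comm _ _ ⟩
    f n + ∑ n (λ i → f (n ∸ suc i))    ≈⟨ ∑-head n (λ i → f (suc n ∸ suc i)) ⟨
    ∑ (suc n) (λ i → f (suc n ∸ suc i)) ∎

  ∑-triangle-suc : ∀ m (G : ℕ → ℕ → Carrier) → ∑ (suc m) (λ j → ∑ (suc m ∸ j) (G j))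
                         ≈ ∑ m (λ j → ∑ (m ∸ j) (G j)) + ∑ (suc m) (λ j → G j (m ∸ j))
  ∑-triangle-suc m G = begin
    ∑ m (λ j → ∑ (suc m ∸ j) (G j)) + ∑ (suc m ∸ m) (G m)
      ≈⟨ +-cong (∑-cong-< m (λ j j<m → ∑-length (G j) (ℕₚ.+-∸-assoc 1 (ℕₚ.<⇒≤ j<m))))
                (∑-length (G m) (ℕₚ.m+n∸n≡m 1 m)) ⟩
    ∑ m (λ j → ∑ (m ∸ j) (G j) + G j (m ∸ j)) + (0# + G m 0)
      ≈⟨ +-cong (∑-distrib-+ m _ _) (trans (+-identityˡ _) (≈-cong (G m) (≡.sym (ℕₚ.n∸n≡0 m)))) ⟩
    (∑ m (λ j → ∑ (m ∸ j) (G j)) + ∑ m (λ j → G j (m ∸ j))) + G m (m ∸ m)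
      ≈⟨ +-assoc _ _ _ ⟩
    ∑ m (λ j → ∑ (m ∸ j) (G j)) + ∑ (suc m) (λ j → G j (m ∸ j)) ∎

  ∑-comm-triangle : ∀ m (G : ℕ → ℕ → Carrier) →
    ∑ m (λ j → ∑ (m ∸ j) (G j)) ≈ ∑ m (λ i → ∑ (m ∸ i) (λ j → G j i))
  ∑-comm-triangle zero    G = refl
  ∑-comm-triangle (suc m) G = begin
    ∑ (suc m) (λ j → ∑ (suc m ∸ j) (G j))
      ≈⟨ ∑-triangle-suc m G ⟩
    ∑ m (λ j → ∑ (m ∸ j) (G j)) + ∑ (suc m) (λ j → G j (m ∸ j))
      ≈⟨ +-cong (∑-comm-triangle m G) antidiagonal ⟩
    ∑ m (λ i → ∑ (m ∸ i) (λ j → G j i)) + ∑ (suc m) (λ i → G (m ∸ i) i)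
      ≈⟨ ∑-triangle-suc m (λ i j → G j i) ⟨
    ∑ (suc m) (λ i → ∑ (suc m ∸ i) (λ j → G j i)) ∎
    where
    antidiagonal : ∑ (suc m) (λ j → G j (m ∸ j)) ≈ ∑ (suc m) (λ i → G (m ∸ i) i)
    antidiagonal = trans (∑-reverse (suc m) (λ j → G j (m ∸ j)))
      (∑-cong-< (suc m) (λ i i<1+m → ≈-cong (G (m ∸ i)) (ℕₚ.m∸[m∸n]≡n (ℕₚ.≤-pred i<1+m))))

  ∏ : ℕ → (ℕ → Carrier) → Carrier
  ∏ zero    f = 1#
  ∏ (suc n) f = f 0 * ∏ n (λ i → f (suc i))

  ∏-cong : ∀ n {f g} → (∀ i → f i ≈ g i) → ∏ n f ≈ ∏ n g
  ∏-cong zero    f≈g = refl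
  ∏-cong (suc n) f≈g = *-cong (f≈g 0) (∏-cong n (λ i → f≈g (suc i)))

  ∏-last : ∀ n f → ∏ (suc n) f ≈ ∏ n f * f n
  ∏-last zero    f = *-comm _ _
  ∏-last (suc n) f = trans (*-congˡ (∏-last n (λ i → f (suc i)))) (sym (*-assoc _ _ _))

  pow-distrib-* : ∀ n x y → pow R x n * pow R y n ≈ pow R (x * y) n
  pow-distrib-* zero    x y = *-identityˡ 1#
  pow-distrib-* (suc n) x y = trans (*-Comm.interchange _ _ _ _) (*-congˡ (pow-distrib-* n x y))

  pow-cong : ∀ n {x y} → x ≈ y → pow R x n ≈ pow R y n
  pow-cong zero    x≈y = refl
  pow-cong (suc n) x≈y = *-cong x≈y (pow-cong n x≈y)

  pow-1# : ∀ n → pow R 1# n ≈ 1#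
  pow-1# zero    = refl
  pow-1# (suc n) = trans (*-identityˡ _) (pow-1# n)

  ∏-scale : ∀ n a f → ∏ n (λ i → a * f i) ≈ pow R a n * ∏ n f
  ∏-scale zero    a f = sym (*-identityˡ 1#)
  ∏-scale (suc n) a f =
    trans (*-congˡ (∏-scale n a (λ i → f (suc i)))) (*-Comm.interchange _ _ _ _)

  rising : ℕ → ℕ → Carrier
  rising s j = ∏ j (λ i → fromℕ R (suc (s ℕ.+ i)))

  sumFin-cong : ∀ n {f g : Fin n → Carrier} → (∀ i → f i ≈ g i) → sumFin R n f ≈ sumFin R n g
  sumFin-cong zero    f≈g = refl
  sumFin-cong (suc n) f≈g = +-cong (f≈g Fin.zero) (sumFin-cong n (λ i → f≈g (Fin.suc i)))

  sumFin-toℕ : ∀ n f → sumFin R n (λ i → f (toℕ i)) ≈ ∑ n f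
  sumFin-toℕ zero    f = refl
  sumFin-toℕ (suc n) f = trans (+-congˡ (sumFin-toℕ n (λ i → f (suc i)))) (sym (∑-head n f))

  det-cong : ∀ n {A B : Fin n → Fin n → Carrier} → (∀ a b → A a b ≈ B a b) → det R n A ≈ det R n B
  det-cong zero    A≈B = refl
  det-cong (suc n) A≈B = sumFin-cong (suc n) λ j →
    *-cong (*-congˡ {pow R (- 1#) (toℕ j)} (A≈B Fin.zero j))
           (det-cong n (λ a b → A≈B (Fin.suc a) (punchIn j b)))

  -- ℕ-indexed matrices, so that minors and diagonal blocks are mere reindexings
  Matrix : Set c
  Matrix = ℕ → ℕ → Carrier

  detℕ : ℕ → Matrix → Carrier
  detℕ n H = det R n (λ a b → H (toℕ a) (toℕ b))

  detℕ-cong : ∀ n {H K : Matrix} → (∀ a b → H a b ≈ K a b) → detℕ n H ≈ detℕ n K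
  detℕ-cong n H≈K = det-cong n (λ a b → H≈K (toℕ a) (toℕ b))

  punchInℕ : ℕ → ℕ → ℕ
  punchInℕ zero    b       = suc b
  punchInℕ (suc j) zero    = zero
  punchInℕ (suc j) (suc b) = suc (punchInℕ j b)

  toℕ-punchIn : ∀ {n} (j : Fin (suc n)) (b : Fin n) → toℕ (punchIn j b) ≡ punchInℕ (toℕ j) (toℕ b)
  toℕ-punchIn Fin.zero    b           = ≡.refl
  toℕ-punchIn (Fin.suc j) Fin.zero    = ≡.refl
  toℕ-punchIn (Fin.suc j) (Fin.suc b) = ≡.cong suc (toℕ-punchIn j b)

  minor : ℕ → Matrix → Matrix
  minor j H a b = H (suc a) (punchInℕ j b)

  subBlock : ℕ → Matrix → Matrix
  subBlock k H a b = H (k ℕ.+ a) (k ℕ.+ b)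

  detℕ-expand : ∀ n H →
    detℕ (suc n) H ≈ ∑ (suc n) (λ j → pow R (- 1#) j * H 0 j * detℕ n (minor j H))
  detℕ-expand n H = trans
    (sumFin-cong (suc n) λ j →
      *-congˡ {pow R (- 1#) (toℕ j) * H 0 (toℕ j)}
              (det-cong n (λ a b → ≈-cong (H (suc (toℕ a))) (toℕ-punchIn j b))))
    (sumFin-toℕ (suc n) (λ j → pow R (- 1#) j * H 0 j * detℕ n (minor j H)))

  detℕ-zeroColumn : ∀ n H → (∀ a → H a 0 ≈ 0#) → detℕ (suc n) H ≈ 0#
  detℕ-zeroColumn n H H₀≈0 = trans (detℕ-expand n H) (∑-zero (suc n) (term n))
    where
    term : ∀ n j → j < suc n → pow R (- 1#) j * H 0 j * detℕ n (minor j H) ≈ 0#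
    term n        zero    _ = trans (*-congʳ (trans (*-congˡ (H₀≈0 0)) (zeroʳ _))) (zeroˡ _)
    term zero     (suc j) (s≤s ())
    term (suc n′) (suc j) _ =
      trans (*-congˡ (detℕ-zeroColumn n′ (minor (suc j) H) (λ a → H₀≈0 (suc a)))) (zeroʳ _)

  detℕ-firstColumn : ∀ n H → (∀ a → H (suc a) 0 ≈ 0#) → detℕ (suc n) H ≈ H 0 0 * detℕ n (subBlock 1 H)
  detℕ-firstColumn n H H₀≈0 = begin
    detℕ (suc n) H
      ≈⟨ trans (detℕ-expand n H) (∑-head n _) ⟩
    1# * H 0 0 * detℕ n (minor 0 H)
      + ∑ n (λ j → pow R (- 1#) (suc j) * H 0 (suc j) * detℕ n (minor (suc j) H))
      ≈⟨ +-cong (*-congʳ (*-identityˡ _)) (∑-zero n (term n)) ⟩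
    H 0 0 * detℕ n (subBlock 1 H) + 0#
      ≈⟨ +-identityʳ _ ⟩
    H 0 0 * detℕ n (subBlock 1 H) ∎
    where
    term : ∀ n j → j < n → pow R (- 1#) (suc j) * H 0 (suc j) * detℕ n (minor (suc j) H) ≈ 0#
    term (suc n′) j _ = trans (*-congˡ (detℕ-zeroColumn n′ (minor (suc j) H) H₀≈0)) (zeroʳ _)

  IsHessenberg : Matrix → Set r
  IsHessenberg H = ∀ a b → suc b < a → H a b ≈ 0#

  -- Deleting column j of a Hessenberg matrix leaves a block-triangular minor whose first block
  -- is upper triangular with the subdiagonal H₁₀, …, H_{j,j-1} on its diagonal.
  detℕ-minor : ∀ j n H → IsHessenberg H → j ≤ n →
    detℕ n (minor j H) ≈ ∏ j (λ i → H (suc i) i) * detℕ (n ∸ j) (subBlock (suc j) H)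
  detℕ-minor zero    n       H hess j≤n = sym (*-identityˡ _)
  detℕ-minor (suc j) (suc n) H hess (s≤s j≤n) = begin
    detℕ (suc n) (minor (suc j) H)
      ≈⟨ detℕ-firstColumn n (minor (suc j) H) (λ a → hess (suc (suc a)) 0 (s≤s (s≤s z≤n))) ⟩
    H 1 0 * detℕ n (minor j (subBlock 1 H))
      ≈⟨ *-congˡ (detℕ-minor j n (subBlock 1 H) (λ a b b<a → hess (suc a) (suc b) (s≤s b<a)) j≤n) ⟩
    H 1 0 * (∏ j (λ i → H (suc (suc i)) (suc i)) * detℕ (n ∸ j) (subBlock (suc (suc j)) H))
      ≈⟨ *-assoc _ _ _ ⟨
    ∏ (suc j) (λ i → H (suc i) i) * detℕ (suc n ∸ suc j) (subBlock (suc (suc j)) H) ∎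

  detℕ-hessenberg : ∀ n H → IsHessenberg H → detℕ (suc n) H ≈
    ∑ (suc n) (λ j → pow R (- 1#) j * H 0 j * (∏ j (λ i → H (suc i) i) * detℕ (n ∸ j) (subBlock (suc j) H)))
  detℕ-hessenberg n H hess = trans (detℕ-expand n H)
    (∑-cong-< (suc n) (λ j j<1+n → *-congˡ (detℕ-minor j n H hess (ℕₚ.≤-pred j<1+n))))

  -- Morally F s m sums, over the compositions m = (j₁ + 1) + ⋯ + (j_k + 1), the products of the
  -- weights w (s + start of the t-th part) j_t; F-first peels off the first part, F-last the last one.
  module Compositions (F w : ℕ → ℕ → Carrier) (F-zero : ∀ s → F s 0 ≈ 1#)
    (F-first : ∀ s m → F s (suc m) ≈ ∑ (suc m) (λ j → w s j * F (suc j ℕ.+ s) (m ∸ j))) where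

    LastPartExpansion : ℕ → Set r
    LastPartExpansion m = ∀ s → F s (suc m) ≈ ∑ (suc m) (λ i → F s (m ∸ i) * w (s ℕ.+ (m ∸ i)) i)

    F-last : ∀ m → LastPartExpansion m
    F-last = <-rec LastPartExpansion step
      where
      step : ∀ m → (∀ {k} → k < m → LastPartExpansion k) → LastPartExpansion m
      step m IH s = begin
        F s (suc m)                               ≈⟨ F-first s m ⟩
        ∑ m T + T m                               ≈⟨ +-cong (trans (∑-cong-< m T≈) swapped) last ⟩
        ∑ m (λ i → F s (m ∸ i) * W i) + F s (m ∸ m) * W m ∎
        where
        W : ℕ → Carrier
        W i = w (s ℕ.+ (m ∸ i)) i
        T : ℕ → Carrier
        T j = w s j * F (suc j ℕ.+ s) (m ∸ j)
        G : ℕ → ℕ → Carrier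
        G j i = w s j * F (suc j ℕ.+ s) (m ∸ suc j ∸ i) * W i

        T≈ : ∀ j → j < m → T j ≈ ∑ (m ∸ j) (G j)
        T≈ j j<m = begin
          w s j * F s′ (m ∸ j)   ≈⟨ *-congˡ (≈-cong (F s′) (∸-suc j<m)) ⟩
          w s j * F s′ (suc k)   ≈⟨ *-congˡ (IH (ℕₚ.∸-monoʳ-< (s≤s z≤n) j<m) s′) ⟩
          w s j * ∑ (suc k) (λ i → F s′ (k ∸ i) * w (s′ ℕ.+ (k ∸ i)) i)
            ≈⟨ trans (*-distribˡ-∑ (suc k) (w s j) _) (∑-cong-< (suc k) reindex) ⟩
          ∑ (suc k) (G j)        ≈⟨ ∑-length (G j) (∸-suc j<m) ⟨
          ∑ (m ∸ j) (G j)        ∎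
          where
          s′ k : ℕ
          s′ = suc j ℕ.+ s
          k = m ∸ suc j
          reindex : ∀ i → i < suc k → w s j * (F s′ (k ∸ i) * w (s′ ℕ.+ (k ∸ i)) i) ≈ G j i
          reindex i i<1+k = trans (sym (*-assoc _ _ _))
            (*-congˡ (≈-cong (λ t → w t i) (+-∸-reindex s j<m (ℕₚ.≤-pred i<1+k))))

        swapped : ∑ m (λ j → ∑ (m ∸ j) (G j)) ≈ ∑ m (λ i → F s (m ∸ i) * W i)
        swapped = trans (∑-comm-triangle m G) (∑-cong-< m λ i i<m → begin
          ∑ (m ∸ i) (λ j → G j i)
            ≈⟨ ∑-cong (m ∸ i) (λ j → *-congʳ (*-congˡ (≈-cong (F (suc j ℕ.+ s)) (∸-suc-comm m j i)))) ⟩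
          ∑ (m ∸ i) (λ j → w s j * F (suc j ℕ.+ s) (m ∸ suc i ∸ j) * W i)
            ≈⟨ *-distribʳ-∑ (m ∸ i) (W i) _ ⟨
          ∑ (m ∸ i) (λ j → w s j * F (suc j ℕ.+ s) (m ∸ suc i ∸ j)) * W i
            ≈⟨ *-congʳ (trans (∑-length _ (∸-suc i<m)) (sym (F-first s (m ∸ suc i)))) ⟩
          F s (suc (m ∸ suc i)) * W i
            ≈⟨ *-congʳ (≈-cong (F s) (∸-suc i<m)) ⟨
          F s (m ∸ i) * W i ∎)

        last : T m ≈ F s (m ∸ m) * W m
        last = begin
          w s m * F (suc m ℕ.+ s) (m ∸ m) ≈⟨ *-congˡ (trans (≈-cong (F _) (ℕₚ.n∸n≡0 m)) (F-zero _)) ⟩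
          w s m * 1#                      ≈⟨ *-comm _ _ ⟩
          1# * w s m                      ≈⟨ *-cong (sym (F-zero s)) (≈-cong (λ t → w t m) (≡.sym (ℕₚ.+-identityʳ s))) ⟩
          F s 0 * w (s ℕ.+ 0) m           ≈⟨ ≈-cong (λ k → F s k * w (s ℕ.+ k) m) (ℕₚ.n∸n≡0 m) ⟨
          F s (m ∸ m) * W m ∎

  fromℕ-+ : ∀ a b → fromℕ R (a ℕ.+ b) ≈ fromℕ R a + fromℕ R b
  fromℕ-+ zero    b = sym (+-identityˡ _)
  fromℕ-+ (suc a) b = trans (+-congˡ (fromℕ-+ a b)) (sym (+-assoc _ _ _))

  -- the Euler operator x d/dx on coefficient sequences
  euler : Series R → Series R
  euler f n = fromℕ R n * f n

  mulS-oneSʳ : ∀ f n → mulS R f (oneS R) n ≈ f n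
  mulS-oneSʳ f n = begin
    ∑ n (λ i → f i * oneS R (n ∸ i)) + f n * oneS R (n ∸ n)
      ≈⟨ +-cong (∑-zero n (λ i i<n → trans (*-congˡ (≈-cong (oneS R) (∸-suc i<n))) (zeroʳ _)))
                (trans (*-congˡ (≈-cong (oneS R) (ℕₚ.n∸n≡0 n))) (*-identityʳ _)) ⟩
    0# + f n ≈⟨ +-identityˡ _ ⟩
    f n ∎

  mulS-scaleʳ : ∀ f g a n → mulS R f (λ k → a * g k) n ≈ a * mulS R f g n
  mulS-scaleʳ f g a n = trans (∑-cong (suc n) (λ i → *-Comm.x∙yz≈y∙xz _ _ _)) (sym (*-distribˡ-∑ (suc n) a _))

  mulS-mulS-triangle : ∀ n (f g h : Series R) →
    mulS R f (mulS R g h) n ≈ ∑ (suc n) (λ i → ∑ (suc n ∸ i) (λ d → f i * (g d * h (n ∸ i ∸ d))))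
  mulS-mulS-triangle n f g h = ∑-cong-< (suc n) λ i i<1+n →
    trans (*-distribˡ-∑ (suc (n ∸ i)) (f i) _) (∑-length _ (≡.sym (ℕₚ.+-∸-assoc 1 (ℕₚ.≤-pred i<1+n))))

  mulS-leftComm : ∀ n (f g h : Series R) → mulS R f (mulS R g h) n ≈ mulS R g (mulS R f h) n
  mulS-leftComm n f g h = begin
    mulS R f (mulS R g h) n
      ≈⟨ mulS-mulS-triangle n f g h ⟩
    ∑ (suc n) (λ i → ∑ (suc n ∸ i) (λ d → f i * (g d * h (n ∸ i ∸ d))))
      ≈⟨ ∑-comm-triangle (suc n) _ ⟩
    ∑ (suc n) (λ d → ∑ (suc n ∸ d) (λ i → f i * (g d * h (n ∸ i ∸ d))))
      ≈⟨ ∑-cong (suc n) (λ d → ∑-cong (suc n ∸ d) λ i →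
           trans (*-Comm.x∙yz≈y∙xz _ _ _) (*-congˡ (*-congˡ (≈-cong h (∸-comm n i d))))) ⟩
    ∑ (suc n) (λ d → ∑ (suc n ∸ d) (λ i → g d * (f i * h (n ∸ d ∸ i))))
      ≈⟨ mulS-mulS-triangle n g f h ⟨
    mulS R g (mulS R f h) n ∎

  euler-mulS : ∀ f g n → euler (mulS R f g) n ≈ mulS R (euler f) g n + mulS R f (euler g) n
  euler-mulS f g n = begin
    fromℕ R n * ∑ (suc n) (λ i → f i * g (n ∸ i))
      ≈⟨ *-distribˡ-∑ (suc n) _ _ ⟩
    ∑ (suc n) (λ i → fromℕ R n * (f i * g (n ∸ i)))
      ≈⟨ ∑-cong-< (suc n) (λ i i<1+n → leibniz i (ℕₚ.≤-pred i<1+n)) ⟩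
    ∑ (suc n) (λ i → euler f i * g (n ∸ i) + f i * euler g (n ∸ i))
      ≈⟨ ∑-distrib-+ (suc n) _ _ ⟩
    mulS R (euler f) g n + mulS R f (euler g) n ∎
    where
    leibniz : ∀ i → i ≤ n → fromℕ R n * (f i * g (n ∸ i)) ≈ euler f i * g (n ∸ i) + f i * euler g (n ∸ i)
    leibniz i i≤n = begin
      fromℕ R n * (f i * g (n ∸ i))
        ≈⟨ *-congʳ (trans (≈-cong (fromℕ R) (≡.sym (ℕₚ.m+[n∸m]≡n i≤n))) (fromℕ-+ i (n ∸ i))) ⟩
      (fromℕ R i + fromℕ R (n ∸ i)) * (f i * g (n ∸ i))
        ≈⟨ distribʳ _ _ _ ⟩
      fromℕ R i * (f i * g (n ∸ i)) + fromℕ R (n ∸ i) * (f i * g (n ∸ i))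
        ≈⟨ +-cong (sym (*-assoc _ _ _)) (*-Comm.x∙yz≈y∙xz _ _ _) ⟩
      euler f i * g (n ∸ i) + f i * euler g (n ∸ i) ∎

  euler-powS : ∀ g k n → euler (powS R g (suc k)) n ≈ fromℕ R (suc k) * mulS R (euler g) (powS R g k) n
  euler-powS g zero n = begin
    fromℕ R n * mulS R g (oneS R) n ≈⟨ *-congˡ (mulS-oneSʳ g n) ⟩
    euler g n                       ≈⟨ mulS-oneSʳ (euler g) n ⟨
    mulS R (euler g) (oneS R) n     ≈⟨ trans (*-congʳ (+-identityʳ 1#)) (*-identityˡ _) ⟨
    (1# + 0#) * mulS R (euler g) (oneS R) n ∎
  euler-powS g (suc k) n = begin
    euler (mulS R g (powS R g (suc k))) n
      ≈⟨ euler-mulS g (powS R g (suc k)) n ⟩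
    X + mulS R g (euler (powS R g (suc k))) n
      ≈⟨ +-congˡ (∑-cong (suc n) (λ i → *-congˡ (euler-powS g k (n ∸ i)))) ⟩
    X + mulS R g (λ t → fromℕ R (suc k) * mulS R (euler g) (powS R g k) t) n
      ≈⟨ +-congˡ (mulS-scaleʳ g (mulS R (euler g) (powS R g k)) (fromℕ R (suc k)) n) ⟩
    X + fromℕ R (suc k) * mulS R g (mulS R (euler g) (powS R g k)) n
      ≈⟨ +-congˡ (*-congˡ (mulS-leftComm n g (euler g) (powS R g k))) ⟩
    X + fromℕ R (suc k) * X
      ≈⟨ trans (distribʳ X 1# _) (+-congʳ (*-identityˡ X)) ⟨
    fromℕ R (suc (suc k)) * X ∎
    where
    X : Carrier
    X = mulS R (euler g) (powS R g (suc k)) n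

  powS-vanish : ∀ g → g 0 ≈ 0# → ∀ k j → j < k → powS R g k j ≈ 0#
  powS-vanish g g₀≈0 (suc k) j j<1+k = ∑-zero (suc j) term
    where
    term : ∀ i → i < suc j → g i * powS R g k (j ∸ i) ≈ 0#
    term zero    _         = trans (*-congʳ g₀≈0) (zeroˡ _)
    term (suc i) (s≤s i<j) = trans (*-congˡ (powS-vanish g g₀≈0 k (j ∸ suc i)
      (ℕₚ.<-≤-trans (ℕₚ.∸-monoʳ-< (s≤s z≤n) i<j) (ℕₚ.≤-pred j<1+k)))) (zeroʳ _)

  -- coefficientwise form of the differential equation u′ = c u
  DiffEq : (c u : Series R) → Set r
  DiffEq c u = ∀ m → fromℕ R (suc m) * u (suc m) ≈ ∑ (suc m) (λ i → c i * u (m ∸ i))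

  DiffEq-respˡ : ∀ {c c′ u} → (∀ i → c i ≈ c′ i) → DiffEq c u → DiffEq c′ u
  DiffEq-respˡ c≈c′ du m = trans (du m) (∑-cong (suc m) (λ i → *-congʳ (c≈c′ i)))

  module ℚ-Algebra (inv : ℕ → Carrier) (inv-correct : ∀ m → fromℕ R (suc m) * inv (suc m) ≈ 1#) where

    inv-correctˡ : ∀ m → inv (suc m) * fromℕ R (suc m) ≈ 1#
    inv-correctˡ m = trans (*-comm _ _) (inv-correct m)

    inv! : ℕ → Carrier
    inv! = invFact R inv

    fromℕ-cancel : ∀ m {x y} → fromℕ R (suc m) * x ≈ fromℕ R (suc m) * y → x ≈ y
    fromℕ-cancel m {x} {y} eq = begin
      x                                   ≈⟨ cancel x ⟨
      inv (suc m) * (fromℕ R (suc m) * x) ≈⟨ *-congˡ eq ⟩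
      inv (suc m) * (fromℕ R (suc m) * y) ≈⟨ cancel y ⟩
      y                                   ∎
      where
      cancel : ∀ z → inv (suc m) * (fromℕ R (suc m) * z) ≈ z
      cancel z = trans (sym (*-assoc _ _ _)) (trans (*-congʳ (inv-correctˡ m)) (*-identityˡ z))

    DiffEq-unique : ∀ {c u v} → u 0 ≈ v 0 → DiffEq c u → DiffEq c v → ∀ n → u n ≈ v n
    DiffEq-unique {c} {u} {v} u₀≈v₀ du dv = <-rec (λ n → u n ≈ v n) step
      where
      step : ∀ n → (∀ {k} → k < n → u k ≈ v k) → u n ≈ v n
      step zero    _  = u₀≈v₀
      step (suc m) IH = fromℕ-cancel m (begin
        fromℕ R (suc m) * u (suc m)      ≈⟨ du m ⟩
        ∑ (suc m) (λ i → c i * u (m ∸ i)) ≈⟨ ∑-cong (suc m) (λ i → *-congˡ (IH (s≤s (ℕₚ.m∸n≤m m i)))) ⟩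
        ∑ (suc m) (λ i → c i * v (m ∸ i)) ≈⟨ dv m ⟨
        fromℕ R (suc m) * v (suc m)      ∎)

    rising-inv! : ∀ a i → rising a i * inv! (a ℕ.+ i) ≈ inv! a
    rising-inv! a zero    = trans (*-identityˡ _) (≈-cong inv! (ℕₚ.+-identityʳ a))
    rising-inv! a (suc i) = begin
      rising a (suc i) * inv! (a ℕ.+ suc i)
        ≈⟨ *-cong (∏-last i _) (≈-cong inv! (ℕₚ.+-suc a i)) ⟩
      (rising a i * fromℕ R (suc (a ℕ.+ i))) * (inv! (a ℕ.+ i) * inv (suc (a ℕ.+ i)))
        ≈⟨ *-Comm.interchange _ _ _ _ ⟩
      (rising a i * inv! (a ℕ.+ i)) * (fromℕ R (suc (a ℕ.+ i)) * inv (suc (a ℕ.+ i)))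
        ≈⟨ *-cong (rising-inv! a i) (inv-correct (a ℕ.+ i)) ⟩
      inv! a * 1#
        ≈⟨ *-identityʳ _ ⟩
      inv! a ∎

    euler-logSeries : ∀ ℓ Y i → euler (logSeries R inv ℓ Y) (suc i) ≈ entryY R ℓ Y i
    euler-logSeries ℓ Y i = trans (*-Comm.x∙yz≈y∙xz _ _ _) (trans (*-congˡ (inv-correct i)) (*-identityʳ _))

    euler-expS : ∀ g m → euler (expS R inv g) (suc m) ≈
      ∑ (suc m) (λ k → inv! k * mulS R (euler g) (powS R g k) (suc m))
    euler-expS g m = begin
      fromℕ R (suc m) * ∑ (suc (suc m)) (λ k → inv! k * powS R g k (suc m))
        ≈⟨ trans (*-distribˡ-∑ (suc (suc m)) _ _) (∑-cong (suc (suc m)) (λ k → *-Comm.x∙yz≈y∙xz _ _ _)) ⟩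
      ∑ (suc (suc m)) (λ k → inv! k * euler (powS R g k) (suc m))
        ≈⟨ ∑-head (suc m) _ ⟩
      1# * (fromℕ R (suc m) * 0#) + ∑ (suc m) (λ k → inv! (suc k) * euler (powS R g (suc k)) (suc m))
        ≈⟨ +-cong (trans (*-congˡ (zeroʳ _)) (zeroʳ _)) (∑-cong (suc m) term) ⟩
      0# + ∑ (suc m) (λ k → inv! k * mulS R (euler g) (powS R g k) (suc m))
        ≈⟨ +-identityˡ _ ⟩
      ∑ (suc m) (λ k → inv! k * mulS R (euler g) (powS R g k) (suc m)) ∎
      where
      term : ∀ k → inv! (suc k) * euler (powS R g (suc k)) (suc m)
                 ≈ inv! k * mulS R (euler g) (powS R g k) (suc m)
      term k = begin
        (inv! k * inv (suc k)) * euler (powS R g (suc k)) (suc m)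
          ≈⟨ *-congˡ (trans (euler-powS g k (suc m)) (*-comm _ _)) ⟩
        (inv! k * inv (suc k)) * (mulS R (euler g) (powS R g k) (suc m) * fromℕ R (suc k))
          ≈⟨ *-Comm.interchange _ _ _ _ ⟩
        (inv! k * mulS R (euler g) (powS R g k) (suc m)) * (inv (suc k) * fromℕ R (suc k))
          ≈⟨ trans (*-congˡ (inv-correctˡ k)) (*-identityʳ _) ⟩
        inv! k * mulS R (euler g) (powS R g k) (suc m) ∎

    module _ (g : Series R) (g₀≈0 : g 0 ≈ 0#) where

      -- The powers g^k with k > j do not contribute to the coefficient of x^j.
      expS-truncate : ∀ m j → j ≤ m → ∑ (suc m) (λ k → inv! k * powS R g k j) ≈ expS R inv g j
      expS-truncate m j j≤m = trans
        (∑-length _ (≡.trans (≡.cong suc (≡.sym (ℕₚ.m∸n+n≡m j≤m))) (≡.sym (ℕₚ.+-suc (m ∸ j) j))))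
        (∑-pad (m ∸ j) (suc j) _ (λ k j<k → trans (*-congˡ (powS-vanish g g₀≈0 k j j<k)) (zeroʳ _)))

      exp-diffEq : DiffEq (λ i → euler g (suc i)) (expS R inv g)
      exp-diffEq m = begin
        euler (expS R inv g) (suc m)
          ≈⟨ euler-expS g m ⟩
        ∑ (suc m) (λ k → inv! k * ∑ (suc (suc m)) (λ d → euler g d * powS R g k (suc m ∸ d)))
          ≈⟨ trans (∑-cong (suc m) (λ k → *-distribˡ-∑ (suc (suc m)) (inv! k) _))
                   (∑-comm (suc m) (suc (suc m)) _) ⟩
        ∑ (suc (suc m)) (λ d → ∑ (suc m) (λ k → inv! k * (euler g d * powS R g k (suc m ∸ d))))
          ≈⟨ ∑-head (suc m) _ ⟩
        ∑ (suc m) (λ k → inv! k * (euler g 0 * powS R g k (suc m)))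
          + ∑ (suc m) (λ i → ∑ (suc m) (λ k → inv! k * (euler g (suc i) * powS R g k (m ∸ i))))
          ≈⟨ +-cong (∑-zero (suc m) (λ k _ → trans (*-congˡ (trans (*-congʳ (zeroˡ _)) (zeroˡ _))) (zeroʳ _)))
                    (∑-cong-< (suc m) (λ i i<1+m → factor i (ℕₚ.≤-pred i<1+m))) ⟩
        0# + ∑ (suc m) (λ i → euler g (suc i) * expS R inv g (m ∸ i))
          ≈⟨ +-identityˡ _ ⟩
        ∑ (suc m) (λ i → euler g (suc i) * expS R inv g (m ∸ i)) ∎
        where
        factor : ∀ i → i ≤ m → ∑ (suc m) (λ k → inv! k * (euler g (suc i) * powS R g k (m ∸ i)))
                               ≈ euler g (suc i) * expS R inv g (m ∸ i)
        factor i i≤m = begin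
          ∑ (suc m) (λ k → inv! k * (euler g (suc i) * powS R g k (m ∸ i)))
            ≈⟨ ∑-cong (suc m) (λ k → *-Comm.x∙yz≈y∙xz _ _ _) ⟩
          ∑ (suc m) (λ k → euler g (suc i) * (inv! k * powS R g k (m ∸ i)))
            ≈⟨ *-distribˡ-∑ (suc m) _ _ ⟨
          euler g (suc i) * ∑ (suc m) (λ k → inv! k * powS R g k (m ∸ i))
            ≈⟨ *-congˡ (expS-truncate m (m ∸ i) (ℕₚ.m∸n≤m m i)) ⟩
          euler g (suc i) * expS R inv g (m ∸ i) ∎

  module BlockDeterminants (ι : Carrier) (ι²≈-1 : ι * ι ≈ - 1#) (ℓ : ℕ) (Y : Fin ℓ → Carrier) where

    e : ℕ → Carrier
    e = entryY R ℓ Y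

    𝕄 : Matrix
    𝕄 = Mentry R ι ℓ Y

    𝕄-upper : ∀ {a b} → a ≤ b → 𝕄 a b ≡ pow R ι (b ∸ a) * e (b ∸ a)
    𝕄-upper {a} {b} a≤b = if-cong (dec-true (a ℕ.≤? b) a≤b)

    𝕄-subdiagonal : ∀ b → 𝕄 (suc b) b ≡ ι * fromℕ R (suc b)
    𝕄-subdiagonal b = ≡.trans (if-cong (dec-false (suc b ℕ.≤? b) (ℕₚ.<-irrefl ≡.refl)))
                              (if-cong (dec-true (suc b ℕ.≟ suc b) ≡.refl))

    𝕄-lower : ∀ {a b} → suc b < a → 𝕄 a b ≡ 0#
    𝕄-lower {a} {b} 1+b<a =
      ≡.trans (if-cong (dec-false (a ℕ.≤? b) (ℕₚ.<⇒≱ (ℕₚ.<-trans (ℕₚ.n<1+n b) 1+b<a))))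
              (if-cong (dec-false (a ℕ.≟ suc b) (ℕₚ.>⇒≢ 1+b<a)))

    block : ℕ → ℕ → Carrier
    block s m = detℕ m (subBlock s 𝕄)

    block-hessenberg : ∀ s → IsHessenberg (subBlock s 𝕄)
    block-hessenberg s a b 1+b<a =
      reflexive (𝕄-lower (≡.subst (_< s ℕ.+ a) (ℕₚ.+-suc s b) (ℕₚ.+-monoʳ-< s 1+b<a)))

    block-row₀ : ∀ s j → subBlock s 𝕄 0 j ≡ pow R ι j * e j
    block-row₀ s j = ≡.trans (𝕄-upper (ℕₚ.+-monoʳ-≤ s z≤n))
      (≡.cong (λ k → pow R ι k * e k) (≡.trans (≡.cong (s ℕ.+ j ∸_) (ℕₚ.+-identityʳ s)) (ℕₚ.m+n∸m≡n s j)))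

    block-subdiagonal : ∀ s i → subBlock s 𝕄 (suc i) i ≡ ι * fromℕ R (suc (s ℕ.+ i))
    block-subdiagonal s i = ≡.trans (≡.cong (λ k → 𝕄 k (s ℕ.+ i)) (ℕₚ.+-suc s i)) (𝕄-subdiagonal (s ℕ.+ i))

    block-shift : ∀ s k m → detℕ m (subBlock k (subBlock s 𝕄)) ≈ block (k ℕ.+ s) m
    block-shift s k m = detℕ-cong m λ a b →
      reflexive (≡.cong₂ 𝕄 (ℕ+.x∙yz≈yx∙z s k a) (ℕ+.x∙yz≈yx∙z s k b))

    sign-cancel : ∀ j → pow R (- 1#) j * (pow R ι j * pow R ι j) ≈ 1#
    sign-cancel j = begin
      pow R (- 1#) j * (pow R ι j * pow R ι j) ≈⟨ *-congˡ (pow-distrib-* j ι ι) ⟩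
      pow R (- 1#) j * pow R (ι * ι) j         ≈⟨ pow-distrib-* j _ _ ⟩
      pow R (- 1# * (ι * ι)) j                 ≈⟨ pow-cong j (trans (*-congˡ ι²≈-1) -1*-1≈1) ⟩
      pow R 1# j                               ≈⟨ pow-1# j ⟩
      1#                                       ∎
      where
      -1*-1≈1 : - 1# * - 1# ≈ 1#
      -1*-1≈1 = trans (-1*x≈-x (- 1#)) (-‿involutive 1#)

    block-first : ∀ s m →
      block s (suc m) ≈ ∑ (suc m) (λ j → (e j * rising s j) * block (suc j ℕ.+ s) (m ∸ j))
    block-first s m = trans (detℕ-hessenberg m H (block-hessenberg s)) (∑-cong (suc m) term)
      where
      H : Matrix
      H = subBlock s 𝕄
      term : ∀ j → pow R (- 1#) j * H 0 j * (∏ j (λ i → H (suc i) i) * detℕ (m ∸ j) (subBlock (suc j) H))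
                 ≈ (e j * rising s j) * block (suc j ℕ.+ s) (m ∸ j)
      term j = begin
        σ * H 0 j * (∏ j (λ i → H (suc i) i) * detℕ (m ∸ j) (subBlock (suc j) H))
          ≈⟨ *-cong (*-congˡ (reflexive (block-row₀ s j)))
                    (*-cong (trans (∏-cong j (λ i → reflexive (block-subdiagonal s i))) (∏-scale j ι _))
                            (block-shift s (suc j) (m ∸ j))) ⟩
        σ * (p * e j) * ((p * ρ) * B)
          ≈⟨ *-assoc _ _ _ ⟩
        σ * ((p * e j) * ((p * ρ) * B))
          ≈⟨ *-congˡ (trans (*-congˡ (*-assoc _ _ _)) (*-Comm.interchange _ _ _ _)) ⟩
        σ * ((p * p) * (e j * (ρ * B)))
          ≈⟨ *-assoc _ _ _ ⟨
        (σ * (p * p)) * (e j * (ρ * B))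
          ≈⟨ *-cong (sign-cancel j) (sym (*-assoc _ _ _)) ⟩
        1# * ((e j * ρ) * B)
          ≈⟨ *-identityˡ _ ⟩
        (e j * ρ) * B ∎
        where
        σ p ρ B : Carrier
        σ = pow R (- 1#) j
        p = pow R ι j
        ρ = rising s j
        B = block (suc j ℕ.+ s) (m ∸ j)

    block-last : ∀ m → block 0 (suc m) ≈ ∑ (suc m) (λ i → block 0 (m ∸ i) * (e i * rising (m ∸ i) i))
    block-last m = F-last m 0
      where open Compositions block (λ s j → e j * rising s j) (λ _ → refl) block-first

    module _ (inv : ℕ → Carrier) (inv-correct : ∀ m → fromℕ R (suc m) * inv (suc m) ≈ 1#) where
      open ℚ-Algebra inv inv-correct

      detSeries-diffEq : DiffEq e (detSeries R inv ι ℓ Y)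
      detSeries-diffEq m = begin
        fromℕ R (suc m) * (block 0 (suc m) * (inv! m * inv (suc m)))
          ≈⟨ trans (*-Comm.x∙yz≈y∙xz _ _ _) (*-congˡ (*-Comm.x∙yz≈y∙xz _ _ _)) ⟩
        block 0 (suc m) * (inv! m * (fromℕ R (suc m) * inv (suc m)))
          ≈⟨ *-congˡ (trans (*-congˡ (inv-correct m)) (*-identityʳ _)) ⟩
        block 0 (suc m) * inv! m
          ≈⟨ trans (*-congʳ (block-last m)) (*-distribʳ-∑ (suc m) _ _) ⟩
        ∑ (suc m) (λ i → block 0 (m ∸ i) * (e i * rising (m ∸ i) i) * inv! m)
          ≈⟨ ∑-cong-< (suc m) (λ i i<1+m → term i (ℕₚ.≤-pred i<1+m)) ⟩
        ∑ (suc m) (λ i → e i * (block 0 (m ∸ i) * inv! (m ∸ i))) ∎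
        where
        term : ∀ i → i ≤ m →
          block 0 (m ∸ i) * (e i * rising (m ∸ i) i) * inv! m ≈ e i * (block 0 (m ∸ i) * inv! (m ∸ i))
        term i i≤m = begin
          block 0 (m ∸ i) * (e i * rising (m ∸ i) i) * inv! m
            ≈⟨ trans (*-congʳ (*-Comm.x∙yz≈y∙xz _ _ _)) (*-assoc _ _ _) ⟩
          e i * ((block 0 (m ∸ i) * rising (m ∸ i) i) * inv! m)
            ≈⟨ *-congˡ (*-assoc _ _ _) ⟩
          e i * (block 0 (m ∸ i) * (rising (m ∸ i) i * inv! m))
            ≈⟨ *-congˡ (*-congˡ (trans (*-congˡ (≈-cong inv! (≡.sym (ℕₚ.m∸n+n≡m i≤m))))
                                       (rising-inv! (m ∸ i) i))) ⟩
          e i * (block 0 (m ∸ i) * inv! (m ∸ i)) ∎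

theorem7p1 : ∀ {c r : Level} (R : CommutativeRing c r) →
    (inv : ℕ → CommutativeRing.Carrier R) →
    (∀ m → CommutativeRing._≈_ R (CommutativeRing._*_ R (fromℕ R (suc m)) (inv (suc m))) (CommutativeRing.1# R)) →
    (ι : CommutativeRing.Carrier R) →
    CommutativeRing._≈_ R (CommutativeRing._*_ R ι ι) (CommutativeRing.-_ R (CommutativeRing.1# R)) →
    (ℓ : ℕ) → 1 ≤ ℓ → (Y : Fin ℓ → CommutativeRing.Carrier R) →
    (n : ℕ) → CommutativeRing._≈_ R (detSeries R inv ι ℓ Y n) (expS R inv (logSeries R inv ℓ Y) n)
theorem7p1 R inv inv-correct ι ι²≈-1 ℓ _ Y = DiffEq-unique constant-terms det-side exp-side
  where
  open CommutativeRing R using (_≈_; sym; refl; +-identityˡ; 1#; _*_)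
  open ℚ-Algebra R inv inv-correct using (DiffEq-unique; euler-logSeries; exp-diffEq)

  g : Series R
  g = logSeries R inv ℓ Y

  constant-terms : detSeries R inv ι ℓ Y 0 ≈ expS R inv g 0
  constant-terms = sym (+-identityˡ (1# * 1#))

  det-side : DiffEq R (entryY R ℓ Y) (detSeries R inv ι ℓ Y)
  det-side = BlockDeterminants.detSeries-diffEq R ι ι²≈-1 ℓ Y inv inv-correct

  exp-side : DiffEq R (entryY R ℓ Y) (expS R inv g)
  exp-side = DiffEq-respˡ R {u = expS R inv g} (euler-logSeries ℓ Y) (exp-diffEq g refl)
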